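{- Let $P$ be a non-empty finite set of primes and let $q$ be the minimum element of $P$. Then the set $\left\{\frac{\|n\|_P}{\log_q n} : n>1\right\}$ is dense in the interval $(\|q\|,\ \|q\|+q-1)$. Consequently, the set $\{\|n\|_{P,\log} : n>1\}$ is dense in the interval $\left(\|q\|_{\log},\ \|q\|_{\log}+\frac{q-1}{\log_3 q}\right)$. (Here a set $S$ is dense in an interval $I$ if every non-empty open subinterval of $I$ contains an element of $S$.)
   Context: For a positive integer $m$, $\|m\|$ denotes the minimum number of occurrences of the constant $1$ in an arithmetic expression built only from the constant $1$, addition, multiplication and parentheses whose value is $m$; for $m>1$, $\|m\|_{\log}=\|m\|/\log_3 m$. Given a non-empty finite set $P$ of primes, the $P$-algorithm builds an expression for $n>0$ as follows: (1) if $n=1$, represent $n$ as $1$ and stop; (2) if $n=p\in P$, represent $n$ by a shortest expression of $p$ (with $\|p\|$ ones) and stop; (3) if $n>1$, $n\notin P$ and $n$ is divisible by some $p\in P$, represent $n$ as (shortest expression of $p$)$\cdot\frac{n}{p}$ and continue with $\frac{n}{p}$; (4) if $n>1$ and $n$ is divisible by no $p\in P$, represent $n$ as $1+(n-1)$ and continue with $n-1$. The number of ones in the resulting expression does not depend on the choices made in step (3); it is denoted $\|n\|_P$. Equivalently: $\|1\|_P=1$; $\|p\|_P=\|p\|$ for $p\in P$; $\|n\|_P=\|p\|+\|n/p\|_P$ if $n>1$, $n\notin P$, $p\in P$, $p\mid n$; $\|n\|_P = 1+\|n-1\|_P$ if $n>1$ is divisible by no element of $P$. For $n>1$, $\|n\|_{P,\log}=\|n\|_P/\log_3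 n$. -}

module Defs where

open import Data.Nat using (ℕ; zero; suc; _+_; _*_; _∸_; _≤_; _≟_)
open import Data.Nat.Divisibility using (_∣_; _∣?_; quotient)
open import Data.List using (List; []; _∷_)
open import Data.List.Membership.DecPropositional _≟_ using (_∈?_)
open import Data.Maybe using (Maybe; just; nothing)
open import Data.Product using (Σ; _×_; _,_)
open import Relation.Nullary using (yes; no)
open import Relation.Binary.PropositionalEquality using (_≡_)

data Expr : Set where
  one  : Expr
  plus : Expr → Expr → Expr
  times : Expr → Expr → Expr

val : Expr → ℕ
val one = 1
val (plus e f) = val e + val f
val (times e f) = val e * val f

ones : Expr → ℕ
ones one = 1
ones (plus e f) = ones e + ones f
ones (times e f) = ones e + ones f

IsComplexity : ℕ → ℕ → Set
IsComplexity m k =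
  (Σ Expr λ e → val e ≡ m × ones e ≡ k) × (∀ e → val e ≡ m → k ≤ ones e)

findDiv : List ℕ → ℕ → Maybe (ℕ × ℕ)
findDiv [] n = nothing
findDiv (p ∷ ps) n with p ∣? n
... | yes p∣n = just (p , quotient p∣n)
... | no _ = findDiv ps n

-- The P-algorithm, with fuel; c is meant to be the complexity ‖·‖.
normPFuel : (ℕ → ℕ) → List ℕ → ℕ → ℕ → ℕ
normPFuel c P zero n = 0
normPFuel c P (suc f) zero = 0
normPFuel c P (suc f) (suc zero) = 1
normPFuel c P (suc f) n@(suc (suc _)) with n ∈? P
... | yes _ = c n
... | no _ with findDiv P n
...   | just (p , k) = c p + normPFuel c P f k
...   | nothing = 1 + normPFuel c P f (n ∸ 1)

-- ‖n‖_P  (fuel n suffices: each step strictly decreases the argument)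
normP : (ℕ → ℕ) → List ℕ → ℕ → ℕ
normP c P n = normPFuel c P n n

{-# OPTIONS --safe #-}
module Submission where

-- Write γ = ‖q‖, δ = ‖q‖ + q − 1 and fix L > 2 divisible by every element of P. The
-- numbers M b = q ^ b * L − 1 are divisible by no element of P, and
-- M (b + 1) = q * M b + (q − 1). The numbers q * M b + i with 0 < i < q are not divisible
-- by any p ∈ P either, for p would divide q * (M b + 1) − (q * M b + i) = q − i, while
-- q ≤ p by minimality of q. So the P-algorithm takes q − 1 unit steps and one division by
-- q to go from M (b + 1) to M b, and a divisions by q to go from q ^ a * M b to M b:
-- ‖q ^ a * M b‖_P = a γ + b δ + ‖M 0‖_P, while
-- q ^ (a + b) ≤ q ^ a * M b < q ^ (a + b + L).
-- With a = k α, b = k β and k large, ‖n‖_P / log_q n comes as close as needed to the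
-- weighted average (α γ + β δ) / (α + β), and these averages realise every rational in
-- (γ, δ). The statement for log₃ follows from the one for log_q, applied to a window
-- ((R + 1) / D, (R + 2) / D) inside (r / s, t / u) · log₃ q.
-- Throughout, a · log x < b · log y is expressed as x ^ a < y ^ b.

open import Defs
open import Data.Nat
open import Data.Nat.Properties
open import Data.Nat.Divisibility
open import Data.Nat.Primality
open import Data.Nat.ListAction using (product)
open import Data.Nat.ListAction.Properties using (∈⇒∣product)
open import Data.Nat.Tactic.RingSolver using (solve-∀; solve)
open import Data.List using (List; []; _∷_)
open import Data.List.Membership.Propositional using (_∈_; _∉_)
open import Data.List.Membership.DecPropositional _≟_ using (_∈?_)
open import Data.List.Relation.Unary.Any using (here; there)
open import Data.List.Relation.Unary.All using (All; lookup)
open import Data.Maybe using (just; nothing)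
open import Data.Product using (Σ; ∃-syntax; ∃₂; _×_; _,_; proj₁; proj₂; map₁)
open import Data.Sum using (inj₁; inj₂)
open import Function using (_∘_)
open import Relation.Nullary using (contradiction)
open import Relation.Nullary.Decidable using (yes; no)
open import Relation.Binary.PropositionalEquality

-- Powers

^-cancelʳ-< : ∀ k {m n} → m ^ k < n ^ k → m < n
^-cancelʳ-< k lt = ≰⇒> λ n≤m → <⇒≱ lt (^-monoˡ-≤ k n≤m)

^-cancelˡ-< : ∀ b .{{_ : NonZero b}} {m n} → b ^ m < b ^ n → m < n
^-cancelˡ-< b lt = ≰⇒> λ n≤m → <⇒≱ lt (^-monoʳ-≤ b n≤m)

^-*-swap : ∀ x a b c d → a * b ≡ c * d → (x ^ a) ^ b ≡ (x ^ c) ^ d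
^-*-swap x a b c d ab≡cd =
  trans (^-*-assoc x a b) (trans (cong (x ^_) ab≡cd) (sym (^-*-assoc x c d)))

n<m^n : ∀ {m} → 1 < m → ∀ n → n < m ^ n
n<m^n 1<m zero = z<s
n<m^n {m} 1<m (suc n) = begin-strict
  suc n       ≤⟨ n<m^n 1<m n ⟩
  m ^ n       <⟨ m<m*n (m ^ n) m 1<m ⟩
  m ^ n * m   ≡⟨ *-comm (m ^ n) m ⟩
  m * m ^ n   ∎
  where
    open ≤-Reasoning
    instance
      m^n≢0′ : NonZero (m ^ n)
      m^n≢0′ = m^n≢0 m n {{>-nonZero (<⇒≤ 1<m)}}

3^[2m]<q^[4m] : ∀ {q} m .{{_ : NonZero m}} → 1 < q → 3 ^ (2 * m) < q ^ (4 * m)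
3^[2m]<q^[4m] {q} m 1<q = begin-strict
  3 ^ (2 * m)  ≡⟨ ^-*-assoc 3 2 m ⟨
  9 ^ m        <⟨ ^-monoˡ-< m (≤-trans (m≤m+n 10 6) (^-monoˡ-≤ 4 1<q)) ⟩
  (q ^ 4) ^ m  ≡⟨ ^-*-assoc q 4 m ⟩
  q ^ (4 * m)  ∎
  where open ≤-Reasoning

^-<-^-<⇒*< : ∀ x y a b c D .{{_ : NonZero x}} .{{_ : NonZero D}} →
  x ^ a < y ^ b → y ^ (b * D) < x ^ c → a * D < c
^-<-^-<⇒*< x y a b c D x^a<y^b y^bD<x^c = ^-cancelˡ-< x (begin-strict
  x ^ (a * D)  ≡⟨ ^-*-assoc x a D ⟨
  (x ^ a) ^ D  <⟨ ^-monoˡ-< D x^a<y^b ⟩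
  (y ^ b) ^ D  ≡⟨ ^-*-assoc y b D ⟩
  y ^ (b * D)  <⟨ y^bD<x^c ⟩
  x ^ c        ∎)
  where open ≤-Reasoning

^-<-^-<⇒<* : ∀ x y a b c D .{{_ : NonZero y}} .{{_ : NonZero D}} →
  x ^ a < y ^ b → y ^ c < x ^ (a * D) → c < b * D
^-<-^-<⇒<* x y a b c D x^a<y^b y^c<x^aD = ^-cancelˡ-< y (begin-strict
  y ^ c        <⟨ y^c<x^aD ⟩
  x ^ (a * D)  ≡⟨ ^-*-assoc x a D ⟨
  (x ^ a) ^ D  <⟨ ^-monoˡ-< D x^a<y^b ⟩
  (y ^ b) ^ D  ≡⟨ ^-*-assoc y b D ⟩
  y ^ (b * D)  ∎)
  where open ≤-Reasoning

rebase-lower : ∀ x y z a D N r s .{{_ : NonZero a}} .{{_ : NonZero r}} →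
  x ^ a < y ^ (D * N) → y ^ (r * D) ≤ z ^ (a * s) → x ^ r < z ^ (s * N)
rebase-lower x y z a D N r s x^a<y^DN y^rD≤z^as = ^-cancelʳ-< a (begin-strict
  (x ^ r) ^ a        ≡⟨ ^-*-swap x r a a r (*-comm r a) ⟩
  (x ^ a) ^ r        <⟨ ^-monoˡ-< r x^a<y^DN ⟩
  (y ^ (D * N)) ^ r  ≡⟨ ^-*-swap y (D * N) r (r * D) N (solve (D ∷ N ∷ r ∷ [])) ⟩
  (y ^ (r * D)) ^ N  ≤⟨ ^-monoˡ-≤ N y^rD≤z^as ⟩
  (z ^ (a * s)) ^ N  ≡⟨ ^-*-swap z (a * s) N (s * N) a (solve (a ∷ s ∷ N ∷ [])) ⟩
  (z ^ (s * N)) ^ a  ∎)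
  where open ≤-Reasoning

rebase-upper : ∀ x y z a D N t u .{{_ : NonZero a}} .{{_ : NonZero t}} →
  y ^ (D * N) < x ^ a → z ^ (u * a) ≤ y ^ (t * D) → z ^ (u * N) < x ^ t
rebase-upper x y z a D N t u y^DN<x^a z^ua≤y^tD = ^-cancelʳ-< a (begin-strict
  (z ^ (u * N)) ^ a  ≡⟨ ^-*-swap z (u * N) a (u * a) N (solve (u ∷ N ∷ a ∷ [])) ⟩
  (z ^ (u * a)) ^ N  ≤⟨ ^-monoˡ-≤ N z^ua≤y^tD ⟩
  (y ^ (t * D)) ^ N  ≡⟨ ^-*-swap y (t * D) N (D * N) t (solve (t ∷ D ∷ N ∷ [])) ⟩
  (y ^ (D * N)) ^ t  <⟨ ^-monoˡ-< t y^DN<x^a ⟩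
  (x ^ a) ^ t        ≡⟨ ^-*-swap x a t t a (*-comm a t) ⟩
  (x ^ t) ^ a        ∎)
  where open ≤-Reasoning

ratio-between : ∀ {q n} m L N r s t u .{{_ : NonZero r}} → 1 < q →
  q ^ m ≤ n → n < q ^ (m + L) → (m + L) * r ≤ s * N → u * N < m * t →
  n ^ r < q ^ (s * N) × q ^ (u * N) < n ^ t
ratio-between {q} {n} m L N r s t u 1<q q^m≤n n<q^[m+L] big small = lower , upper
  where
    open ≤-Reasoning
    instance
      q≢0 : NonZero q
      q≢0 = >-nonZero (<⇒≤ 1<q)
    lower : n ^ r < q ^ (s * N)
    lower = begin-strict
      n ^ r               <⟨ ^-monoˡ-< r n<q^[m+L] ⟩
      (q ^ (m + L)) ^ r   ≡⟨ ^-*-assoc q (m + L) r ⟩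
      q ^ ((m + L) * r)   ≤⟨ ^-monoʳ-≤ q big ⟩
      q ^ (s * N)         ∎
    upper : q ^ (u * N) < n ^ t
    upper = begin-strict
      q ^ (u * N)         <⟨ ^-monoʳ-< q 1<q small ⟩
      q ^ (m * t)         ≡⟨ ^-*-assoc q m t ⟨
      (q ^ m) ^ t         ≤⟨ ^-monoˡ-≤ t q^m≤n ⟩
      n ^ t               ∎

-- Rational parameters

weighted-average : ∀ {γ d S X} → γ * S ≤ X → X ≤ (γ + d) * S →
  ∃₂ λ α β → α + β ≡ S * d × α * γ + β * (γ + d) ≡ X * d
weighted-average {γ} {d} {S} {X} γS≤X X≤δS
  with m≤n⇒∃[o]m+o≡n γS≤X | m≤n⇒∃[o]m+o≡n X≤δS
... | β , γS+β≡X | α , X+α≡δS = α , β , α+β≡Sd , average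
  where
    open ≡-Reasoning
    α+β≡Sd : α + β ≡ S * d
    α+β≡Sd = +-cancelˡ-≡ (γ * S) (α + β) (S * d) (begin
      γ * S + (α + β)  ≡⟨ solve (γ ∷ S ∷ α ∷ β ∷ []) ⟩
      (γ * S + β) + α  ≡⟨ cong (_+ α) γS+β≡X ⟩
      X + α            ≡⟨ X+α≡δS ⟩
      (γ + d) * S      ≡⟨ solve (γ ∷ d ∷ S ∷ []) ⟩
      γ * S + S * d    ∎)
    average : α * γ + β * (γ + d) ≡ X * d
    average = begin
      α * γ + β * (γ + d)  ≡⟨ solve (α ∷ β ∷ γ ∷ d ∷ []) ⟩
      (α + β) * γ + β * d  ≡⟨ cong (λ σ → σ * γ + β * d) α+β≡Sd ⟩
      S * d * γ + β * d    ≡⟨ solve (S ∷ d ∷ γ ∷ β ∷ []) ⟩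
      (γ * S + β) * d      ≡⟨ cong (_* d) γS+β≡X ⟩
      X * d                ∎

weights-between : ∀ γ d r s t u .{{_ : NonZero d}} .{{_ : NonZero s}} .{{_ : NonZero u}} →
  γ * s < r → r * u < t * s → t < (γ + d) * u →
  ∃₂ λ α β → (α + β) * r < s * (α * γ + β * (γ + d))
           × u * (α * γ + β * (γ + d)) < (α + β) * t
weights-between γ d r s t u γs<r ru<ts t<δu = weights (weighted-average γS≤X X≤δS)
  where
    open ≤-Reasoning
    -- the midpoint X / S of r / s and t / u
    X S : ℕ
    X = r * u + t * s
    S = 2 * (s * u)
    γS≤X : γ * S ≤ X
    γS≤X = begin
      γ * (2 * (s * u))      ≡⟨ solve (γ ∷ s ∷ u ∷ []) ⟩
      γ * s * u + γ * s * u  ≤⟨ +-mono-≤ γsu≤ru γsu≤ru ⟩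
      r * u + r * u          ≤⟨ +-monoʳ-≤ (r * u) (<⇒≤ ru<ts) ⟩
      X                      ∎
      where
        γsu≤ru : γ * s * u ≤ r * u
        γsu≤ru = *-monoˡ-≤ u (<⇒≤ γs<r)
    X≤δS : X ≤ (γ + d) * S
    X≤δS = begin
      X                                  ≤⟨ +-monoˡ-≤ (t * s) (<⇒≤ ru<ts) ⟩
      t * s + t * s                      ≤⟨ +-mono-≤ ts≤δus ts≤δus ⟩
      (γ + d) * u * s + (γ + d) * u * s  ≡⟨ solve (γ ∷ d ∷ u ∷ s ∷ []) ⟩
      (γ + d) * (2 * (s * u))            ∎
      where
        ts≤δus : t * s ≤ (γ + d) * u * s
        ts≤δus = *-monoˡ-≤ s (<⇒≤ t<δu)
    lower : S * d * r < s * (X * d)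
    lower = begin-strict
      2 * (s * u) * d * r      ≡⟨ solve (s ∷ u ∷ d ∷ r ∷ []) ⟩
      s * (r * u + r * u) * d  <⟨ *-monoˡ-< d (*-monoʳ-< s (+-monoʳ-< (r * u) ru<ts)) ⟩
      s * X * d                ≡⟨ *-assoc s X d ⟩
      s * (X * d)              ∎
    upper : u * (X * d) < S * d * t
    upper = begin-strict
      u * (X * d)              ≡⟨ *-assoc u X d ⟨
      u * X * d                <⟨ *-monoˡ-< d (*-monoʳ-< u (+-monoˡ-< (t * s) ru<ts)) ⟩
      u * (t * s + t * s) * d  ≡⟨ solve (u ∷ t ∷ s ∷ d ∷ []) ⟩
      2 * (s * u) * d * t      ∎
    weights : (∃₂ λ α β → α + β ≡ S * d × α * γ + β * (γ + d) ≡ X * d) →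
      ∃₂ λ α β → (α + β) * r < s * (α * γ + β * (γ + d))
               × u * (α * γ + β * (γ + d)) < (α + β) * t
    weights (α , β , α+β≡Sd , W≡Xd) = α , β
      , subst₂ (λ σ W → σ * r < s * W) (sym α+β≡Sd) (sym W≡Xd) lower
      , subst₂ (λ σ W → u * W < σ * t) (sym α+β≡Sd) (sym W≡Xd) upper

amplify : ∀ σ W r s t u k C L → σ * r < s * W → u * W < σ * t → L * r ≤ k → u * C < k →
  (k * σ + L) * r ≤ s * (k * W + C) × u * (k * W + C) < k * σ * t
amplify σ W r s t u k C L σr<sW uW<σt Lr≤k uC<k = lower , upper
  where
    open ≤-Reasoning
    lower : (k * σ + L) * r ≤ s * (k * W + C)
    lower = begin
      (k * σ + L) * r        ≡⟨ *-distribʳ-+ r (k * σ) L ⟩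
      k * σ * r + L * r      ≤⟨ +-monoʳ-≤ (k * σ * r) Lr≤k ⟩
      k * σ * r + k          ≡⟨ solve (k ∷ σ ∷ r ∷ []) ⟩
      k * suc (σ * r)        ≤⟨ *-monoʳ-≤ k σr<sW ⟩
      k * (s * W)            ≤⟨ m≤m+n (k * (s * W)) (s * C) ⟩
      k * (s * W) + s * C    ≡⟨ solve (k ∷ s ∷ W ∷ C ∷ []) ⟩
      s * (k * W + C)        ∎
    upper : u * (k * W + C) < k * σ * t
    upper = begin-strict
      u * (k * W + C)        ≡⟨ solve (u ∷ k ∷ W ∷ C ∷ []) ⟩
      k * (u * W) + u * C    <⟨ +-monoʳ-< (k * (u * W)) uC<k ⟩
      k * (u * W) + k        ≡⟨ solve (k ∷ u ∷ W ∷ []) ⟩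
      k * suc (u * W)        ≤⟨ *-monoʳ-≤ k uW<σt ⟩
      k * (σ * t)            ≡⟨ *-assoc k σ t ⟨
      k * σ * t              ∎

crossing : ∀ (f : ℕ → ℕ) {x} → f 0 ≤ x → ∀ b → x < f b →
  ∃[ a ] f a ≤ x × x < f (suc a)
crossing f f0≤x zero x<f0 = contradiction f0≤x (<⇒≱ x<f0)
crossing f {x} f0≤x (suc b) x<f[1+b] with f b ≤? x
... | yes fb≤x = b , fb≤x , x<f[1+b]
... | no fb≰x = crossing f f0≤x b (≰⇒> fb≰x)

upper-approximant : ∀ x y r s t u D R .{{_ : NonZero y}} .{{_ : NonZero s}} →
  x ^ (R * s) ≤ y ^ (r * D) → x ^ (2 * (s * u)) < y ^ D → r * u < t * s →
  x ^ (u * (2 + R)) < y ^ (t * D)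
upper-approximant x y r s t u D R x^Rs≤y^rD x^2su<y^D ru<ts = ^-cancelʳ-< s (begin-strict
  (x ^ (u * (2 + R))) ^ s                ≡⟨ ^-*-assoc x (u * (2 + R)) s ⟩
  x ^ (u * (2 + R) * s)                  ≡⟨ cong (x ^_) {u * (2 + R) * s} {R * s * u + 2 * (s * u)}
                                              (solve (u ∷ R ∷ s ∷ [])) ⟩
  x ^ (R * s * u + 2 * (s * u))          ≡⟨ ^-distribˡ-+-* x (R * s * u) (2 * (s * u)) ⟩
  x ^ (R * s * u) * x ^ (2 * (s * u))    ≡⟨ cong (_* x ^ (2 * (s * u))) (^-*-assoc x (R * s) u) ⟨
  (x ^ (R * s)) ^ u * x ^ (2 * (s * u))  ≤⟨ *-monoˡ-≤ (x ^ (2 * (s * u))) (^-monoˡ-≤ u x^Rs≤y^rD) ⟩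
  (y ^ (r * D)) ^ u * x ^ (2 * (s * u))  <⟨ *-monoʳ-< ((y ^ (r * D)) ^ u) x^2su<y^D ⟩
  (y ^ (r * D)) ^ u * y ^ D              ≡⟨ cong (_* y ^ D) (^-*-assoc y (r * D) u) ⟩
  y ^ (r * D * u) * y ^ D                ≡⟨ ^-distribˡ-+-* y (r * D * u) D ⟨
  y ^ (r * D * u + D)                    ≡⟨ cong (y ^_) {r * D * u + D} {(1 + r * u) * D}
                                              (solve (r ∷ D ∷ u ∷ [])) ⟩
  y ^ ((1 + r * u) * D)                  ≤⟨ ^-monoʳ-≤ y (*-monoˡ-≤ D ru<ts) ⟩
  y ^ (t * s * D)                        ≡⟨ cong (y ^_) {t * s * D} {t * D * s}
                                              (solve (t ∷ s ∷ D ∷ [])) ⟩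
  y ^ (t * D * s)                        ≡⟨ ^-*-assoc y (t * D) s ⟨
  (y ^ (t * D)) ^ s                      ∎)
  where
    open ≤-Reasoning
    instance
      [y^rD]^u≢0 : NonZero ((y ^ (r * D)) ^ u)
      [y^rD]^u≢0 = m^n≢0 (y ^ (r * D)) u {{m^n≢0 y (r * D)}}

-- With ℓ = log₃ q, the window ((R + 1) / D, (R + 2) / D) starts above r ℓ / s and ends
-- within 2 / D = 1 / (2 s u) of it, which is less than ℓ / (s u) ≤ (t / u − r / s) ℓ
-- because 3² < q⁴.
rational-approximation : ∀ q γ δ r s t u .{{_ : NonZero s}} .{{_ : NonZero u}} → 1 < q →
  3 ^ (s * γ) < q ^ r → r * u < t * s → q ^ t < 3 ^ (u * δ) →
  ∃₂ λ R D → NonZero D × γ * D < suc R × 2 + R < δ * D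
           × q ^ (r * D) ≤ 3 ^ (suc R * s) × 3 ^ (u * (2 + R)) ≤ q ^ (t * D)
rational-approximation q γ δ r s t u 1<q 3^sγ<q^r ru<ts q^t<3^uδ
  with crossing (λ R → 3 ^ (R * s)) (m^n>0 q {{>-nonZero (<⇒≤ 1<q)}} (r * (4 * (s * u))))
         (q ^ (r * (4 * (s * u))))
         (<-≤-trans (n<m^n (s≤s (s≤s z≤n)) (q ^ (r * (4 * (s * u)))))
                    (^-monoʳ-≤ 3 (m≤m*n (q ^ (r * (4 * (s * u)))) s)))
... | R , 3^Rs≤q^rD , q^rD<3^[1+R]s =
  R , D , D≢0 , γD<1+R , 2+R<δD , <⇒≤ q^rD<3^[1+R]s , <⇒≤ 3^u[2+R]<q^tD
  where
    D : ℕ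
    D = 4 * (s * u)
    instance
      q≢0 : NonZero q
      q≢0 = >-nonZero (<⇒≤ 1<q)
      su≢0 : NonZero (s * u)
      su≢0 = m*n≢0 s u
      D≢0 : NonZero D
      D≢0 = m*n≢0 4 (s * u)
    3^u[2+R]<q^tD : 3 ^ (u * (2 + R)) < q ^ (t * D)
    3^u[2+R]<q^tD = upper-approximant 3 q r s t u D R 3^Rs≤q^rD (3^[2m]<q^[4m] (s * u) 1<q) ru<ts
    γD<1+R : γ * D < suc R
    γD<1+R = *-cancelʳ-< s (γ * D) (suc R)
      (subst (_< suc R * s) (trans (*-assoc s γ D) (*-comm s (γ * D)))
        (^-<-^-<⇒*< 3 q (s * γ) r (suc R * s) D 3^sγ<q^r q^rD<3^[1+R]s))
    2+R<δD : 2 + R < δ * D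
    2+R<δD = *-cancelˡ-< u (2 + R) (δ * D)
      (subst (u * (2 + R) <_) (*-assoc u δ D)
        (^-<-^-<⇒<* q 3 t (u * δ) (u * (2 + R)) D q^t<3^uδ 3^u[2+R]<q^tD))

-- The P-algorithm

Free : List ℕ → ℕ → Set
Free P n = ∀ {p} → p ∈ P → p ∤ n

findDiv-just : ∀ P n {p k} → findDiv P n ≡ just (p , k) → p ∈ P × n ≡ k * p
findDiv-just (x ∷ P) n eq with x ∣? n
findDiv-just (x ∷ P) n refl | yes (divides k n≡kx) = here refl , n≡kx
... | no _ = map₁ there (findDiv-just P n eq)

findDiv≡nothing⇒free : ∀ P n → findDiv P n ≡ nothing → Free P n
findDiv≡nothing⇒free (x ∷ P) n eq p∈P p∣n with x ∣? n
findDiv≡nothing⇒free (x ∷ P) n () _ _ | yes _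
findDiv≡nothing⇒free (x ∷ P) n eq (here refl) p∣n | no x∤n = x∤n p∣n
findDiv≡nothing⇒free (x ∷ P) n eq (there p∈P) p∣n | no _ =
  findDiv≡nothing⇒free P n eq p∈P p∣n

free⇒findDiv≡nothing : ∀ P n → Free P n → findDiv P n ≡ nothing
free⇒findDiv≡nothing [] n free = refl
free⇒findDiv≡nothing (x ∷ P) n free with x ∣? n
... | yes x∣n = contradiction x∣n (free (here refl))
... | no _ = free⇒findDiv≡nothing P n (free ∘ there)

prime∣prime⇒≡ : ∀ {p q} → Prime p → Prime q → p ∣ q → p ≡ q
prime∣prime⇒≡ p-prime q-prime p∣q with prime⇒irreducible q-prime p∣q
... | inj₁ refl = contradiction p-prime ¬prime[1]
... | inj₂ p≡q = p≡q

module PAlgorithm (c : ℕ → ℕ) (P : List ℕ) (allP : All Prime P) where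

  ‖_‖P : ℕ → ℕ
  ‖ n ‖P = normP c P n

  ∈P⇒1< : ∀ {p} → p ∈ P → 1 < p
  ∈P⇒1< p∈P = nonTrivial⇒n>1 _ {{prime⇒nonTrivial (lookup allP p∈P)}}

  findDiv-quotient< : ∀ {n p k} .{{_ : NonZero n}} → findDiv P n ≡ just (p , k) → k < n
  findDiv-quotient< {n} eq with findDiv-just P n eq
  ... | p∈P , n≡kp = quotient-< (divides _ n≡kp) {{prime⇒nonTrivial (lookup allP p∈P)}}

  normPFuel-irrelevant : ∀ f g n → n ≤ f → n ≤ g → normPFuel c P f n ≡ normPFuel c P g n
  normPFuel-irrelevant zero    zero    _    _ _ = refl
  normPFuel-irrelevant zero    (suc g) zero _ _ = refl
  normPFuel-irrelevant (suc f) zero    zero _ _ = refl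
  normPFuel-irrelevant (suc f) (suc g) zero _ _ = refl
  normPFuel-irrelevant (suc f) (suc g) 1    _ _ = refl
  normPFuel-irrelevant (suc f) (suc g) n@(suc (suc m)) (s≤s n≤f) (s≤s n≤g) with n ∈? P
  ... | yes _ = refl
  ... | no _ with findDiv P n in eq
  ...   | just (p , k) = cong (c p +_) (normPFuel-irrelevant f g k (k≤ n≤f) (k≤ n≤g))
    where
      k≤ : ∀ {h} → suc m ≤ h → k ≤ h
      k≤ = ≤-trans (s≤s⁻¹ (findDiv-quotient< eq))
  ...   | nothing = cong suc (normPFuel-irrelevant f g (suc m) n≤f n≤g)

  normP-free : ∀ {n} → 1 < n → Free P n → ‖ n ‖P ≡ 1 + ‖ n ∸ 1 ‖P
  normP-free {n@(suc (suc m))} (s≤s (s≤s _)) n-free with n ∈? P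
  ... | yes n∈P = contradiction ∣-refl (n-free n∈P)
  ... | no _ rewrite free⇒findDiv≡nothing P n n-free = refl

  normP-div : ∀ {n p k} → 1 < n → n ∉ P → findDiv P n ≡ just (p , k) →
              ‖ n ‖P ≡ c p + ‖ k ‖P
  normP-div {n@(suc (suc m))} {p} {k} (s≤s (s≤s _)) n∉P eq with n ∈? P
  ... | yes n∈P = contradiction n∈P n∉P
  ... | no _ rewrite eq =
    cong (c p +_) (normPFuel-irrelevant (suc m) k k (s≤s⁻¹ (findDiv-quotient< eq)) ≤-refl)

  module Minimum (q : ℕ) (q∈P : q ∈ P) (q-min : ∀ {p} → p ∈ P → q ≤ p) where

    1<q : 1 < q
    1<q = ∈P⇒1< q∈P

    δ : ℕ
    δ = c q + (q ∸ 1)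

    instance
      q≢0 : NonZero q
      q≢0 = >-nonZero (<⇒≤ 1<q)
      q∸1≢0 : NonZero (q ∸ 1)
      q∸1≢0 = >-nonZero (m<n⇒0<n∸m 1<q)

    OnlyQ : ℕ → Set
    OnlyQ x = ∀ {p} → p ∈ P → p ∣ x → p ≡ q

    free⇒onlyQ : ∀ {x} → Free P x → OnlyQ x
    free⇒onlyQ x-free p∈P p∣x = contradiction p∣x (x-free p∈P)

    onlyQ-q* : ∀ {x} → OnlyQ x → OnlyQ (q * x)
    onlyQ-q* {x} only p∈P p∣qx with euclidsLemma q x (lookup allP p∈P) p∣qx
    ... | inj₁ p∣q = prime∣prime⇒≡ (lookup allP p∈P) (lookup allP q∈P) p∣q
    ... | inj₂ p∣x = only p∈P p∣x

    normP-q* : ∀ {x} → 1 < x → OnlyQ x → ‖ q * x ‖P ≡ c q + ‖ x ‖P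
    normP-q* {x} 1<x only with findDiv P (q * x) in eq
    ... | nothing = contradiction (m∣m*n x) (findDiv≡nothing⇒free P (q * x) eq q∈P)
    ... | just (p , k) with findDiv-just P (q * x) eq
    ... | p∈P , qx≡kp with onlyQ-q* only p∈P (divides k qx≡kp)
    ... | refl = trans (normP-div 1<qx qx∉P eq) (cong (λ k → c q + ‖ k ‖P) k≡x)
      where
        q<qx : q < q * x
        q<qx = m<m*n q x 1<x
        1<qx : 1 < q * x
        1<qx = <-trans 1<q q<qx
        qx∉P : q * x ∉ P
        qx∉P qx∈P = composite⇒¬prime (composite q<qx (m∣m*n x)) (lookup allP qx∈P)
          where
            instance
              q-nonTrivial : NonTrivial q
              q-nonTrivial = prime⇒nonTrivial (lookup allP q∈P)
        k≡x : k ≡ x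
        k≡x = *-cancelʳ-≡ k x q (trans (sym qx≡kp) (*-comm q x))

    normP-q^* : ∀ {m} → 1 < m → Free P m → ∀ a → ‖ q ^ a * m ‖P ≡ a * c q + ‖ m ‖P
    normP-q^* {m} 1<m m-free = go
      where
        onlyQ : ∀ a → OnlyQ (q ^ a * m)
        onlyQ zero = subst OnlyQ (sym (*-identityˡ m)) (free⇒onlyQ m-free)
        onlyQ (suc a) = subst OnlyQ (sym (*-assoc q (q ^ a) m)) (onlyQ-q* (onlyQ a))
        go : ∀ a → ‖ q ^ a * m ‖P ≡ a * c q + ‖ m ‖P
        go zero = cong ‖_‖P (*-identityˡ m)
        go (suc a) = begin
          ‖ q * q ^ a * m ‖P        ≡⟨ cong ‖_‖P (*-assoc q (q ^ a) m) ⟩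
          ‖ q * (q ^ a * m) ‖P      ≡⟨ normP-q* 1<q^a*m (onlyQ a) ⟩
          c q + ‖ q ^ a * m ‖P      ≡⟨ cong (c q +_) (go a) ⟩
          c q + (a * c q + ‖ m ‖P)  ≡⟨ +-assoc (c q) (a * c q) ‖ m ‖P ⟨
          suc a * c q + ‖ m ‖P      ∎
          where
            open ≡-Reasoning
            1<q^a*m : 1 < q ^ a * m
            1<q^a*m = <-≤-trans 1<m (m≤n*m m (q ^ a) {{m^n≢0 q a}})

    below-multiple⇒free : ∀ {y j} → 0 < j → j < q → (∀ {p} → p ∈ P → p ∣ j + y) →
                          Free P y
    below-multiple⇒free {y} {j} 0<j j<q P∣j+y {p} p∈P p∣y =
      >⇒∤ {{>-nonZero 0<j}} (<-≤-trans j<q (q-min p∈P)) p∣j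
      where
        p∣j : p ∣ j
        p∣j = ∣m+n∣m⇒∣n (subst (p ∣_) (+-comm j y) (P∣j+y p∈P)) p∣y

    normP-q*+ : ∀ {x} → 1 < x → (∀ {p} → p ∈ P → p ∣ suc x) →
                ∀ i → i < q → ‖ q * x + i ‖P ≡ i + (c q + ‖ x ‖P)
    normP-q*+ {x} 1<x P∣1+x zero _ = trans (cong ‖_‖P (+-identityʳ (q * x)))
      (normP-q* 1<x (free⇒onlyQ (below-multiple⇒free z<s 1<q P∣1+x)))
    normP-q*+ {x} 1<x P∣1+x (suc i) 1+i<q = begin
      ‖ q * x + suc i ‖P      ≡⟨ cong ‖_‖P (+-suc (q * x) i) ⟩
      ‖ suc (q * x + i) ‖P    ≡⟨ normP-free 1<1+qx+i free ⟩
      suc ‖ q * x + i ‖P      ≡⟨ cong suc (normP-q*+ 1<x P∣1+x i (<-trans (n<1+n i) 1+i<q)) ⟩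
      suc i + (c q + ‖ x ‖P)  ∎
      where
        open ≡-Reasoning
        1<1+qx+i : 1 < suc (q * x + i)
        1<1+qx+i = s≤s (m≤n⇒m≤n+o i (<⇒≤ (<-trans 1<q (m<m*n q x 1<x))))
        j : ℕ
        j = q ∸ suc i
        j+[qx+1+i]≡q[1+x] : j + suc (q * x + i) ≡ q * suc x
        j+[qx+1+i]≡q[1+x] = begin
          j + suc (q * x + i)  ≡⟨ solve (q ∷ x ∷ i ∷ []) ⟩
          q * x + (suc i + j)  ≡⟨ cong (q * x +_) (m+[n∸m]≡n (<⇒≤ 1+i<q)) ⟩
          q * x + q            ≡⟨ +-comm (q * x) q ⟩
          q + q * x            ≡⟨ *-suc q x ⟨
          q * suc x            ∎
        free : Free P (suc (q * x + i))
        free = below-multiple⇒free (m<n⇒0<n∸m 1+i<q)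
          (∸-monoʳ-< {q} {suc i} {0} z<s (<⇒≤ 1+i<q))
          λ {p} p∈P → subst (p ∣_) (sym j+[qx+1+i]≡q[1+x]) (∣n⇒∣m*n q (P∣1+x p∈P))

    module Witness (L : ℕ) (2<L : 2 < L) (P∣L : ∀ {p} → p ∈ P → p ∣ L) where

      M : ℕ → ℕ
      M b = q ^ b * L ∸ 1

      L≤q^b*L : ∀ b → L ≤ q ^ b * L
      L≤q^b*L b = m≤n*m L (q ^ b) {{m^n≢0 q b}}

      suc-M : ∀ b → suc (M b) ≡ q ^ b * L
      suc-M b = m+[n∸m]≡n (≤-trans (<-trans z<s 2<L) (L≤q^b*L b))

      1<M : ∀ b → 1 < M b
      1<M b = s≤s⁻¹ (subst (2 <_) (sym (suc-M b)) (≤-trans 2<L (L≤q^b*L b)))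

      P∣suc-M : ∀ b {p} → p ∈ P → p ∣ suc (M b)
      P∣suc-M b {p} p∈P = subst (p ∣_) (sym (suc-M b)) (∣n⇒∣m*n (q ^ b) (P∣L p∈P))

      M-free : ∀ b → Free P (M b)
      M-free b = below-multiple⇒free z<s 1<q (P∣suc-M b)

      M-suc : ∀ b → q * M b + (q ∸ 1) ≡ M (suc b)
      M-suc b = suc-injective (begin
        suc (q * M b + (q ∸ 1))  ≡⟨ +-suc (q * M b) (q ∸ 1) ⟨
        q * M b + suc (q ∸ 1)    ≡⟨ cong (q * M b +_) (suc-pred q) ⟩
        q * M b + q              ≡⟨ +-comm (q * M b) q ⟩
        q + q * M b              ≡⟨ *-suc q (M b) ⟨
        q * suc (M b)            ≡⟨ cong (q *_) (suc-M b) ⟩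
        q * (q ^ b * L)          ≡⟨ *-assoc q (q ^ b) L ⟨
        q ^ suc b * L            ≡⟨ suc-M (suc b) ⟨
        suc (M (suc b))          ∎)
        where open ≡-Reasoning

      normP-M : ∀ b → ‖ M b ‖P ≡ b * δ + ‖ M 0 ‖P
      normP-M zero = refl
      normP-M (suc b) = begin
        ‖ M (suc b) ‖P                        ≡⟨ cong ‖_‖P (M-suc b) ⟨
        ‖ q * M b + (q ∸ 1) ‖P                ≡⟨ normP-q*+ (1<M b) (P∣suc-M b) (q ∸ 1) q∸1<q ⟩
        (q ∸ 1) + (c q + ‖ M b ‖P)            ≡⟨ cong (λ n → (q ∸ 1) + (c q + n)) (normP-M b) ⟩
        (q ∸ 1) + (c q + (b * δ + ‖ M 0 ‖P))  ≡⟨ rearrange (q ∸ 1) (c q) b ‖ M 0 ‖P ⟩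
        suc b * δ + ‖ M 0 ‖P                  ∎
        where
          open ≡-Reasoning
          q∸1<q : q ∸ 1 < q
          q∸1<q = ∸-monoʳ-< z<s (<⇒≤ 1<q)
          rearrange : ∀ d γ b C → d + (γ + (b * (γ + d) + C)) ≡ suc b * (γ + d) + C
          rearrange = solve-∀

      normP-witness : ∀ a b → ‖ q ^ a * M b ‖P ≡ a * c q + b * δ + ‖ M 0 ‖P
      normP-witness a b = begin
        ‖ q ^ a * M b ‖P              ≡⟨ normP-q^* (1<M b) (M-free b) a ⟩
        a * c q + ‖ M b ‖P            ≡⟨ cong (a * c q +_) (normP-M b) ⟩
        a * c q + (b * δ + ‖ M 0 ‖P)  ≡⟨ +-assoc (a * c q) (b * δ) ‖ M 0 ‖P ⟨
        a * c q + b * δ + ‖ M 0 ‖P    ∎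
        where open ≡-Reasoning

      witness-bounds : ∀ a b → q ^ (a + b) ≤ q ^ a * M b × q ^ a * M b < q ^ (a + b + L)
      witness-bounds a b = lower , upper
        where
          open ≤-Reasoning
          instance
            q^a≢0 : NonZero (q ^ a)
            q^a≢0 = m^n≢0 q a
            q^b≢0 : NonZero (q ^ b)
            q^b≢0 = m^n≢0 q b
          q^b≤M : q ^ b ≤ M b
          q^b≤M = s≤s⁻¹ (begin
            suc (q ^ b)  ≤⟨ m<m*n (q ^ b) L (<-trans ≤-refl 2<L) ⟩
            q ^ b * L    ≡⟨ suc-M b ⟨
            suc (M b)    ∎)
          lower : q ^ (a + b) ≤ q ^ a * M b
          lower = begin
            q ^ (a + b)    ≡⟨ ^-distribˡ-+-* q a b ⟩
            q ^ a * q ^ b  ≤⟨ *-monoʳ-≤ (q ^ a) q^b≤M ⟩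
            q ^ a * M b    ∎
          upper : q ^ a * M b < q ^ (a + b + L)
          upper = begin-strict
            q ^ a * M b              <⟨ *-monoʳ-< (q ^ a) (n<1+n (M b)) ⟩
            q ^ a * suc (M b)        ≡⟨ cong (q ^ a *_) (suc-M b) ⟩
            q ^ a * (q ^ b * L)      <⟨ *-monoʳ-< (q ^ a) (*-monoʳ-< (q ^ b) (n<m^n 1<q L)) ⟩
            q ^ a * (q ^ b * q ^ L)  ≡⟨ *-assoc (q ^ a) (q ^ b) (q ^ L) ⟨
            q ^ a * q ^ b * q ^ L    ≡⟨ cong (_* q ^ L) (^-distribˡ-+-* q a b) ⟨
            q ^ (a + b) * q ^ L      ≡⟨ ^-distribˡ-+-* q (a + b) L ⟨
            q ^ (a + b + L)          ∎

      witness-between : ∀ r s t u α β .{{_ : NonZero r}} →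
        (α + β) * r < s * (α * c q + β * δ) → u * (α * c q + β * δ) < (α + β) * t →
        ∃[ n ] 1 < n × n ^ r < q ^ (s * ‖ n ‖P) × q ^ (u * ‖ n ‖P) < n ^ t
      witness-between r s t u α β σr<sW uW<σt =
        n , 1<n , ratio-between m L ‖ n ‖P r s t u 1<q low high big small
        where
          W C k n m : ℕ
          W = α * c q + β * δ
          C = ‖ M 0 ‖P
          -- k is large enough to absorb the offsets L of log_q n and C of ‖ n ‖P
          k = suc (L * r + u * C)
          n = q ^ (k * α) * M (k * β)
          m = k * α + k * β
          1<n : 1 < n
          1<n = <-≤-trans (1<M (k * β)) (m≤n*m (M (k * β)) (q ^ (k * α)) {{m^n≢0 q (k * α)}})
          ‖n‖≡ : ‖ n ‖P ≡ k * W + C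
          ‖n‖≡ = trans (normP-witness (k * α) (k * β)) (cong (_+ C) (begin
            k * α * c q + k * β * δ      ≡⟨ cong₂ _+_ (*-assoc k α (c q)) (*-assoc k β δ) ⟩
            k * (α * c q) + k * (β * δ)  ≡⟨ *-distribˡ-+ k (α * c q) (β * δ) ⟨
            k * W                        ∎))
            where open ≡-Reasoning
          m≡kσ : m ≡ k * (α + β)
          m≡kσ = sym (*-distribˡ-+ k α β)
          amplified : (k * (α + β) + L) * r ≤ s * (k * W + C) × u * (k * W + C) < k * (α + β) * t
          amplified = amplify (α + β) W r s t u k C L σr<sW uW<σt
            (≤-trans (m≤m+n (L * r) (u * C)) (n≤1+n _)) (s≤s (m≤n+m (u * C) (L * r)))
          big : (m + L) * r ≤ s * ‖ n ‖P
          big = subst₂ (λ m N → (m + L) * r ≤ s * N) (sym m≡kσ) (sym ‖n‖≡)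
                  (proj₁ amplified)
          small : u * ‖ n ‖P < m * t
          small = subst₂ (λ m N → u * N < m * t) (sym m≡kσ) (sym ‖n‖≡) (proj₂ amplified)
          low : q ^ m ≤ n
          low = proj₁ (witness-bounds (k * α) (k * β))
          high : n < q ^ (m + L)
          high = proj₂ (witness-bounds (k * α) (k * β))

      dense-q : ∀ r s t u .{{_ : NonZero s}} .{{_ : NonZero u}} →
        c q * s < r → r * u < t * s → t < δ * u →
        ∃[ n ] 1 < n × n ^ r < q ^ (s * ‖ n ‖P) × q ^ (u * ‖ n ‖P) < n ^ t
      dense-q r s t u γs<r ru<ts t<δu =
        let α , β , σr<sW , uW<σt = weights-between (c q) (q ∸ 1) r s t u γs<r ru<ts t<δu
        in witness-between r s t u α β {{>-nonZero (<-≤-trans z<s γs<r)}} σr<sW uW<σt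

      dense-3 : ∀ r s t u .{{_ : NonZero s}} .{{_ : NonZero u}} →
        3 ^ (s * c q) < q ^ r → r * u < t * s → q ^ t < 3 ^ (u * δ) →
        ∃[ n ] 1 < n × n ^ r < 3 ^ (s * ‖ n ‖P) × 3 ^ (u * ‖ n ‖P) < n ^ t
      dense-3 r s t u 3^sγ<q^r ru<ts q^t<3^uδ =
        let R , D , D≢0 , γD<1+R , 2+R<δD , q^rD≤3^[1+R]s , 3^u[2+R]≤q^tD =
              rational-approximation q (c q) δ r s t u 1<q 3^sγ<q^r ru<ts q^t<3^uδ
            n , 1<n , n^[1+R]<q^DN , q^DN<n^[2+R] =
              dense-q (suc R) D (2 + R) D {{D≢0}} {{D≢0}}
                γD<1+R (*-monoˡ-< D {{D≢0}} (n<1+n (suc R))) 2+R<δD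
        in n , 1<n
         , rebase-lower n q 3 (suc R) D ‖ n ‖P r s {{_}} {{r≢0}} n^[1+R]<q^DN q^rD≤3^[1+R]s
         , rebase-upper n q 3 (2 + R) D ‖ n ‖P t u {{_}} {{t≢0}} q^DN<n^[2+R] 3^u[2+R]≤q^tD
        where
          r≢0 : NonZero r
          r≢0 = ≢-nonZero λ { refl → <⇒≱ 3^sγ<q^r (m^n>0 3 (s * c q)) }
          t≢0 : NonZero t
          t≢0 = ≢-nonZero λ { refl → n≮0 ru<ts }

-- Only the value c q enters the construction.
lemma2 : (c : ℕ → ℕ) → (∀ m → 1 ≤ m → IsComplexity m (c m)) →
    (P : List ℕ) → P ≢ [] → All Prime P →
    (q : ℕ) → q ∈ P → (∀ p → p ∈ P → q ≤ p) →
    ((r s t u : ℕ) → 0 < s → 0 < u →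
      c q * s < r → r * u < t * s → t < (c q + q ∸ 1) * u →
      Σ ℕ λ n → 1 < n × n ^ r < q ^ (s * normP c P n)
                      × q ^ (u * normP c P n) < n ^ t)
    ×
    ((r s t u : ℕ) → 0 < s → 0 < u →
      3 ^ (s * c q) < q ^ r → r * u < t * s → q ^ t < 3 ^ (u * (c q + q ∸ 1)) →
      Σ ℕ λ n → 1 < n × n ^ r < 3 ^ (s * normP c P n)
                      × 3 ^ (u * normP c P n) < n ^ t)
lemma2 c _ P _ allP q q∈P q-min =
    (λ r s t u 0<s 0<u γs<r ru<ts t<δu →
       dense-q r s t u {{>-nonZero 0<s}} {{>-nonZero 0<u}} γs<r ru<ts
         (subst (λ δ → t < δ * u) δ≡ t<δu))
  , (λ r s t u 0<s 0<u 3^sγ<q^r ru<ts q^t<3^uδ →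
       dense-3 r s t u {{>-nonZero 0<s}} {{>-nonZero 0<u}} 3^sγ<q^r ru<ts
         (subst (λ δ → q ^ t < 3 ^ (u * δ)) δ≡ q^t<3^uδ))
  where
    open PAlgorithm c P allP
    open Minimum q q∈P (q-min _)
    L : ℕ
    L = 3 * product P
    2<L : 2 < L
    2<L = m≤m*n 3 (product P) {{productOfPrimes≢0 allP}}
    P∣L : ∀ {p} → p ∈ P → p ∣ L
    P∣L = ∣n⇒∣m*n 3 ∘ ∈⇒∣product
    open Witness L 2<L P∣L
    δ≡ : c q + q ∸ 1 ≡ δ
    δ≡ = +-∸-assoc (c q) (<⇒≤ 1<q)
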